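{- Let $f:\{0,1\}^n\to\{0,1\}$ be a zebra function with $\mathrm{alt}(f)=k$. Then: (1) The sets $\mathrm{STRIPE}_f(0),\dots,\mathrm{STRIPE}_f(k)$ are pairwise disjoint and their union is $\{0,1\}^n$. (2) For each $i\in\{0,\dots,k-1\}$, $x\in\mathrm{STRIPE}_f(i)$ and $y\in\mathrm{STRIPE}_f(i+1)$, we have $f(x)\ne f(y)$. (3) For each $i\in\{0,\dots,k\}$ and $x\in\mathrm{STRIPE}_f(i)$, there exists $y\le x$ that is a minimal point of $\mathrm{STRIPE}_f(i)$, and there exists $y\ge x$ that is a maximal point of $\mathrm{STRIPE}_f(i)$. (4) Let $x$ be a minimal (resp. maximal) point of $\mathrm{STRIPE}_f(i)$ and let $j\in[n]$ with $x_j=1$ (resp. $x_j=0$). Let $y$ be obtained from $x$ by flipping the $j$-th bit. Then $y\in\mathrm{STRIPE}_f(i-1)$ (resp. $y\in\mathrm{STRIPE}_f(i+1)$). In particular, $f(y)\ne f(x)$. (5) For any $j\in[n]$ and $b\in\{0,1\}$, the restriction $f|_{x_j=b}$ (a function on $\{0,1\}^{[n]\setminus\{j\}}$) is a zebra function.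
   Context: For $x,y\in\{0,1\}^n$, $x\le y$ means $x_i\le y_i$ for all $i$, and $x<y$ means $x\le y$, $x\ne y$. A monotone path from $p$ to $q$ ($p\le q$) is a sequence $p=x^{(1)},\dots,x^{(k)}=q$ where each $x^{(i+1)}$ is obtained from $x^{(i)}$ by changing a single $0$-bit to $1$; its alternation number w.r.t. $f$ is the number of $i$ with $f(x^{(i)})\ne f(x^{(i+1)})$. $\mathrm{alt}(f)$ is the maximum alternation number of a monotone path from $0^n$ to $1^n$. $f$ is a zebra function if all monotone paths from $0^n$ to $1^n$ have the same alternation number. For a zebra function $f$ and $x\in\{0,1\}^n$, $\mathrm{alt}_f(x)$ is the alternation number of any monotone path from $0^n$ to $x$ (this is independent of the path). $\mathrm{STRIPE}_f(i)=\{x:\mathrm{alt}_f(x)=i\}$. A point $x\in\mathrm{STRIPE}_f(i)$ is minimal (resp. maximal) in $\mathrm{STRIPE}_f(i)$ if no $y<x$ (resp. $y>x$) lies in $\mathrm{STRIPE}_f(i)$. -}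

module Defs where

open import Data.Bool using (Bool; true; false; _≤_; if_then_else_)
open import Data.Bool.Properties using (_≟_)
open import Relation.Nullary using (¬_; does)
open import Data.Nat using (ℕ; zero; suc; _+_; pred) renaming (_≤_ to _≤ℕ_)
open import Data.Fin using (Fin)
open import Data.Vec using (Vec; lookup; replicate; insertAt; _[_]≔_)
open import Data.Product using (Σ; ∃; _×_; _,_)
open import Relation.Binary.PropositionalEquality using (_≡_; _≢_)

-- Points of the cube {0,1}^n, with false = 0 and true = 1.
Pt : ℕ → Set
Pt n = Vec Bool n

zeros : ∀ n → Pt n
zeros n = replicate n false

ones : ∀ n → Pt n
ones n = replicate n true

_≼_ : ∀ {n} → Pt n → Pt n → Set
x ≼ y = ∀ j → lookup x j ≤ lookup y j

_≺_ : ∀ {n} → Pt n → Pt n → Set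
x ≺ y = (x ≼ y) × (x ≢ y)

Step : ∀ {n} → Pt n → Pt n → Set
Step {n} x y = Σ (Fin n) λ j → (lookup x j ≡ false) × (y ≡ x [ j ]≔ true)

data MonPath {n : ℕ} : Pt n → Pt n → Set where
  here : ∀ {x} → MonPath x x
  _∷_  : ∀ {x y z} → Step x y → MonPath y z → MonPath x z

δ : Bool → Bool → ℕ
δ a b = if does (a ≟ b) then 0 else 1

altNum : ∀ {n} (f : Pt n → Bool) {p q : Pt n} → MonPath p q → ℕ
altNum f here = 0
altNum f (_∷_ {x} {y} _ π) = δ (f x) (f y) + altNum f π

IsAlt : ∀ {n} → (Pt n → Bool) → ℕ → Set
IsAlt {n} f k =
  (Σ (MonPath (zeros n) (ones n)) λ π → altNum f π ≡ k)
  × (∀ (π : MonPath (zeros n) (ones n)) → altNum f π ≤ℕ k)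

Zebra : ∀ {n} → (Pt n → Bool) → Set
Zebra {n} f = ∀ (π ρ : MonPath (zeros n) (ones n)) → altNum f π ≡ altNum f ρ

-- x ∈ STRIPE_f(i), i.e. alt_f(x) = i : the alternation number of a
-- monotone path from 0^n to x equals i (for zebra f this is path-independent)
Stripe : ∀ {n} → (Pt n → Bool) → ℕ → Pt n → Set
Stripe {n} f i x = Σ (MonPath (zeros n) x) λ π → altNum f π ≡ i

MinimalIn : ∀ {n} → (Pt n → Bool) → ℕ → Pt n → Set
MinimalIn f i x = Stripe f i x × (∀ y → y ≺ x → ¬ Stripe f i y)

MaximalIn : ∀ {n} → (Pt n → Bool) → ℕ → Pt n → Set
MaximalIn f i x = Stripe f i x × (∀ y → x ≺ y → ¬ Stripe f i y)

-- restriction f|_{x_j = b} as a function on {0,1}^{[n] \ {j}} (n-1 coordinates,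
-- in their original order; the fixed bit b is inserted at position j)
restrict : ∀ {n} → (Pt n → Bool) → Fin n → Bool → Pt (pred n) → Bool
restrict {suc m} f j b z = f (insertAt z j b)

{-# OPTIONS --safe #-}
-- Every concatenation of monotone paths adds alternation numbers, so for a zebra
-- function alt_f(x) is well defined and monotone in x; stripes are therefore
-- order-convex, which makes a one-bit descent (ascent) end at a minimal (maximal)
-- point. The value of f flips exactly at each alternation, so f(x) is determined by
-- the parity of alt_f(x). Restricting f to a face x_j = b embeds the monotone paths
-- of the face into those of the cube, where they are path-independent.
module Submission where

open import Defs
open import Data.Bool using (Bool; true; false; not; b≤b; f≤t) renaming (_≤_ to _≤ᵇ_)
import Data.Bool.Properties as Bool
open import Data.Nat using (ℕ; zero; suc; _+_; _≤_; _<_)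
import Data.Nat.Properties as ℕ
open import Data.Nat.GeneralisedArithmetic using (iterate)
open import Data.Fin using (Fin; zero; suc)
import Data.Fin.Properties as Fin
open import Data.Vec using ([]; _∷_; lookup; map; insertAt; _[_]≔_)
open import Data.Vec.Properties
  using (lookup-replicate; lookup-map; lookup∘update; lookup∘update′; []≔-idempotent; []≔-lookup;
         tabulate∘lookup; tabulate-cong)
open import Data.Product using (Σ; _×_; _,_; proj₁)
open import Data.Sum using (_⊎_; inj₁; inj₂)
open import Function using (_∘_)
open import Relation.Nullary using (¬_; yes; no; contradiction)
open import Relation.Nullary.Decidable using (_×-dec_; map′)
open import Relation.Unary using (Decidable)
open import Relation.Binary.PropositionalEquality
  using (_≡_; _≢_; refl; sym; trans; cong; cong₂; subst; module ≡-Reasoning)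

private variable
  n m i i′ k : ℕ
  a c : Bool
  p q r x y z : Pt n
  j : Fin n

_++ₚ_ : MonPath p q → MonPath q r → MonPath p r
here    ++ₚ ρ = ρ
(s ∷ π) ++ₚ ρ = s ∷ (π ++ₚ ρ)

altNum-++ : (f : Pt n → Bool) (π : MonPath p q) (ρ : MonPath q r) →
            altNum f (π ++ₚ ρ) ≡ altNum f π + altNum f ρ
altNum-++ f here ρ = refl
altNum-++ f (_∷_ {x} {y} _ π) ρ =
  trans (cong (δ (f x) (f y) +_) (altNum-++ f π ρ)) (sym (ℕ.+-assoc (δ (f x) (f y)) (altNum f π) _))

∷-step : Step x y → Step (a ∷ x) (a ∷ y)
∷-step (j , xj≡0 , refl) = suc j , xj≡0 , refl

∷-path : MonPath x y → MonPath (a ∷ x) (a ∷ y)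
∷-path here    = here
∷-path (s ∷ π) = ∷-step s ∷ ∷-path π

pathBetween : ∀ (x y : Pt n) → x ≼ y → MonPath x y
pathBetween []       []       _   = here
pathBetween (_ ∷ x) (_ ∷ y) x≼y with x≼y zero
... | b≤b = ∷-path (pathBetween x y (x≼y ∘ suc))
... | f≤t = ∷-path (pathBetween x y (x≼y ∘ suc)) ++ₚ ((zero , refl , refl) ∷ here)

zeros-≼ : ∀ (x : Pt n) → zeros n ≼ x
zeros-≼ x j = subst (_≤ᵇ lookup x j) (sym (lookup-replicate j false)) (Bool.≤-minimum _)

≼-ones : ∀ (x : Pt n) → x ≼ ones n
≼-ones x j = subst (lookup x j ≤ᵇ_) (sym (lookup-replicate j true)) (Bool.≤-maximum _)

≼-[]≔true : ∀ (x : Pt n) j → x ≼ (x [ j ]≔ true)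
≼-[]≔true x j j′ with j′ Fin.≟ j
... | yes refl = subst (lookup x j′ ≤ᵇ_) (sym (lookup∘update j′ x true)) (Bool.≤-maximum _)
... | no j′≢j  = Bool.≤-reflexive (sym (lookup∘update′ j′≢j x true))

[]≔false-≼ : ∀ (x : Pt n) j → (x [ j ]≔ false) ≼ x
[]≔false-≼ x j j′ with j′ Fin.≟ j
... | yes refl = subst (_≤ᵇ lookup x j′) (sym (lookup∘update j′ x false)) (Bool.≤-minimum _)
... | no j′≢j  = Bool.≤-reflexive (lookup∘update′ j′≢j x false)

≼-[]≔false : ∀ (y x : Pt n) j → y ≼ x → lookup y j ≡ false → y ≼ (x [ j ]≔ false)
≼-[]≔false y x j y≼x yj≡0 j′ with j′ Fin.≟ j
... | yes refl = Bool.≤-reflexive (trans yj≡0 (sym (lookup∘update j′ x false)))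
... | no j′≢j  = subst (lookup y j′ ≤ᵇ_) (sym (lookup∘update′ j′≢j x false)) (y≼x j′)

step⇒≺ : Step x y → x ≺ y
step⇒≺ {x = x} (j , xj≡0 , refl) = ≼-[]≔true x j , λ x≡x′ →
  false≢true (trans (sym xj≡0) (trans (cong (λ v → lookup v j) x≡x′) (lookup∘update j x true)))
  where
  false≢true : false ≢ true
  false≢true ()

lowering-step : lookup x j ≡ true → Step (x [ j ]≔ false) x
lowering-step {x = x} {j} xj≡1 =
  j , lookup∘update j x false ,
  sym (trans ([]≔-idempotent x j) (trans (cong (x [ j ]≔_) (sym xj≡1)) ([]≔-lookup x j)))

≺⇒separating-coordinate : y ≺ x → Σ (Fin n) λ j → lookup y j ≡ false × lookup x j ≡ true
≺⇒separating-coordinate {y = y} {x} (y≼x , y≢x)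
  with Fin.any? (λ j → (lookup y j Bool.≟ false) ×-dec (lookup x j Bool.≟ true))
... | yes separating = separating
... | no none = contradiction (lookup-extensionality agree) y≢x
  where
  ≤ᵇ-cases : a ≤ᵇ c → a ≡ c ⊎ (a ≡ false × c ≡ true)
  ≤ᵇ-cases b≤b = inj₁ refl
  ≤ᵇ-cases f≤t = inj₂ (refl , refl)

  agree : ∀ j → lookup y j ≡ lookup x j
  agree j with ≤ᵇ-cases (y≼x j)
  ... | inj₁ yj≡xj = yj≡xj
  ... | inj₂ yj<xj = contradiction (j , yj<xj) none

  lookup-extensionality : (∀ j → lookup y j ≡ lookup x j) → y ≡ x
  lookup-extensionality eq =
    trans (sym (tabulate∘lookup y)) (trans (tabulate-cong eq) (tabulate∘lookup x))

weight : Pt n → ℕ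
weight []          = 0
weight (false ∷ x) = weight x
weight (true ∷ x)  = suc (weight x)

weight-[]≔false : ∀ (x : Pt n) j → lookup x j ≡ true → suc (weight (x [ j ]≔ false)) ≡ weight x
weight-[]≔false (true ∷ x)  zero    refl = refl
weight-[]≔false (false ∷ x) zero    ()
weight-[]≔false (false ∷ x) (suc j) xj≡1 = weight-[]≔false x j xj≡1
weight-[]≔false (true ∷ x)  (suc j) xj≡1 = cong suc (weight-[]≔false x j xj≡1)

complement : Pt n → Pt n
complement = map not

complement-involutive : ∀ (x : Pt n) → complement (complement x) ≡ x
complement-involutive []      = refl
complement-involutive (a ∷ x) = cong₂ _∷_ (Bool.not-involutive a) (complement-involutive x)

complement-antitone : ∀ (x y : Pt n) → x ≼ y → complement y ≼ complement x
complement-antitone x y x≼y j =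
  subst₂ (sym (lookup-map j not y)) (sym (lookup-map j not x)) (not-antitone (x≼y j))
  where
  not-antitone : a ≤ᵇ c → not c ≤ᵇ not a
  not-antitone b≤b = b≤b
  not-antitone f≤t = f≤t

  subst₂ : ∀ {a a′ c c′} → a ≡ a′ → c ≡ c′ → a ≤ᵇ c → a′ ≤ᵇ c′
  subst₂ refl refl a≤c = a≤c

complement-antitone-≺ : ∀ (x y : Pt n) → x ≺ y → complement y ≺ complement x
complement-antitone-≺ x y (x≼y , x≢y) =
  complement-antitone x y x≼y ,
  λ cy≡cx → x≢y (trans (sym (complement-involutive x))
                      (trans (cong complement (sym cy≡cx)) (complement-involutive y)))

Convex : (Pt n → Set) → Set
Convex P = ∀ {x y z} → P x → P z → x ≼ y → y ≼ z → P y

Minimal : (Pt n → Set) → Pt n → Set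
Minimal P x = P x × (∀ y → y ≺ x → ¬ P y)

Maximal : (Pt n → Set) → Pt n → Set
Maximal P x = P x × (∀ y → x ≺ y → ¬ P y)

module _ {P : Pt n → Set} (P? : Decidable P) (convex : Convex P) where

  -- By convexity, a point is minimal as soon as no single 1-bit can be cleared.
  minimal-below : P x → Σ (Pt n) λ y → y ≼ x × Minimal P y
  minimal-below {x = x} = descend (weight x) refl
    where
    descend : ∀ w {x} → weight x ≡ w → P x → Σ (Pt n) λ y → y ≼ x × Minimal P y
    descend w {x} wx≡w px with Fin.any? (λ j → (lookup x j Bool.≟ true) ×-dec P? (x [ j ]≔ false))
    ... | no stuck = x , (λ _ → Bool.≤-refl) , px , λ y y≺x py →
      let (j , yj≡0 , xj≡1) = ≺⇒separating-coordinate y≺x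
      in stuck (j , xj≡1 , convex py px (≼-[]≔false y x j (proj₁ y≺x) yj≡0) ([]≔false-≼ x j))
    ... | yes (j , xj≡1 , px′) = continue w (trans (weight-[]≔false x j xj≡1) wx≡w)
      where
      continue : ∀ w → suc (weight (x [ j ]≔ false)) ≡ w → Σ (Pt n) λ y → y ≼ x × Minimal P y
      continue zero ()
      continue (suc w) eq with descend w (ℕ.suc-injective eq) px′
      ... | y , y≼x′ , minimal = y , (λ j′ → Bool.≤-trans (y≼x′ j′) ([]≔false-≼ x j j′)) , minimal

convex-complement : {P : Pt n → Set} → Convex P → Convex (P ∘ complement)
convex-complement convex {x} {y} {z} px pz x≼y y≼z =
  convex {complement z} {complement y} {complement x}
         pz px (complement-antitone y z y≼z) (complement-antitone x y x≼y)

module _ {P : Pt n → Set} (P? : Decidable P) (convex : Convex P) where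

  -- Complementation reverses the order, turning minimal points of P ∘ complement into maximal points of P.
  maximal-above : P x → Σ (Pt n) λ y → x ≼ y × Maximal P y
  maximal-above {x = x} px
    with minimal-below (P? ∘ complement) (convex-complement {P = P} convex) {complement x}
           (subst P (sym (complement-involutive x)) px)
  ... | y , y≼x′ , py , minimal =
    complement y ,
    subst (_≼ complement y) (complement-involutive x) (complement-antitone y (complement x) y≼x′) ,
    py ,
    λ z y′≺z pz → minimal (complement z)
      (subst (complement z ≺_) (complement-involutive y) (complement-antitone-≺ (complement y) z y′≺z))
      (subst P (sym (complement-involutive z)) pz)

δ-≡ : a ≡ c → δ a c ≡ 0
δ-≡ {false} refl = refl
δ-≡ {true}  refl = refl

δ-≢ : a ≢ c → δ a c ≡ 1
δ-≢ {false} {false} a≢c = contradiction refl a≢c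
δ-≢ {false} {true}  _   = refl
δ-≢ {true}  {false} _   = refl
δ-≢ {true}  {true}  a≢c = contradiction refl a≢c

iterate-not-δ : ∀ a c m → iterate not a (δ a c + m) ≡ iterate not c m
iterate-not-δ false false m = refl
iterate-not-δ false true  m = refl
iterate-not-δ true  false m = refl
iterate-not-δ true  true  m = refl

iterate-not-≢ : a ≢ c → iterate not a m ≢ iterate not c m
iterate-not-≢ {m = zero}  a≢c = a≢c
iterate-not-≢ {m = suc m} a≢c = iterate-not-≢ {m = m} (a≢c ∘ Bool.not-injective)

altAt : (Pt n → Bool) → Pt n → ℕ
altAt f x = altNum f (pathBetween (zeros _) x (zeros-≼ x))

module _ (f : Pt n → Bool) where

  stripe-altAt : ∀ x → Stripe f (altAt f x) x
  stripe-altAt x = pathBetween _ x (zeros-≼ x) , refl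

  stripe-step : Step y z → Stripe f i y → Stripe f (i + δ (f y) (f z)) z
  stripe-step s (π , refl) =
    π ++ₚ (s ∷ here) , trans (altNum-++ f π (s ∷ here)) (cong (altNum f π +_) (ℕ.+-identityʳ _))

  stripe-step-≡ : f y ≡ f z → Step y z → Stripe f i y → Stripe f i z
  stripe-step-≡ {z = z} {i} fy≡fz s sy =
    subst (λ i → Stripe f i z) (trans (cong (i +_) (δ-≡ fy≡fz)) (ℕ.+-identityʳ i)) (stripe-step s sy)

  stripe-step-≢ : f y ≢ f z → Step y z → Stripe f i y → Stripe f (suc i) z
  stripe-step-≢ {z = z} {i} fy≢fz s sy =
    subst (λ i → Stripe f i z) (trans (cong (i +_) (δ-≢ fy≢fz)) (ℕ.+-comm i 1)) (stripe-step s sy)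

  stripe-extend : Stripe f i y → y ≼ z → Σ ℕ λ i′ → i ≤ i′ × Stripe f i′ z
  stripe-extend {y = y} {z} (π , refl) y≼z =
    _ , ℕ.m≤m+n _ _ , π ++ₚ σ , altNum-++ f π σ
    where σ = pathBetween y z y≼z

  stripe-≤-alt : IsAlt f k → Stripe f i x → i ≤ k
  stripe-≤-alt {x = x} (_ , bounded) sx with stripe-extend {z = ones _} sx (≼-ones x)
  ... | _ , i≤i′ , (π , refl) = ℕ.≤-trans i≤i′ (bounded π)

  path-value : (π : MonPath p q) → f q ≡ iterate not (f p) (altNum f π)
  path-value here = refl
  path-value (_∷_ {x} {y} _ π) = trans (path-value π) (sym (iterate-not-δ (f x) (f y) (altNum f π)))

  adjacent-stripes-differ : Stripe f i x → Stripe f (suc i) y → f x ≢ f y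
  adjacent-stripes-differ {i} (π , refl) (ρ , altρ≡1+i) fx≡fy =
    iterate-not-≢ {m = i} (Bool.not-¬ refl) (trans (sym (path-value π)) (trans fx≡fy fy))
    where
    fy = trans (path-value ρ) (cong (iterate not (f (zeros _))) altρ≡1+i)

  maximal-upper-neighbour : MaximalIn f i x → lookup x j ≡ false →
                            Stripe f (suc i) (x [ j ]≔ true) × f (x [ j ]≔ true) ≢ f x
  maximal-upper-neighbour {x = x} {j} (sx , maximal) xj≡0 =
    stripe-step-≢ (fx′≢fx ∘ sym) up sx , fx′≢fx
    where
    up : Step x (x [ j ]≔ true)
    up = j , xj≡0 , refl

    fx′≢fx : f (x [ j ]≔ true) ≢ f x
    fx′≢fx fx′≡fx = maximal _ (step⇒≺ up) (stripe-step-≡ (sym fx′≡fx) up sx)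

module _ (f : Pt n → Bool) (zebra : Zebra f) where

  altNum-path-independent : (π ρ : MonPath p q) → altNum f π ≡ altNum f ρ
  altNum-path-independent {p = p} {q} π ρ =
    ℕ.+-cancelʳ-≡ (altNum f ω) _ _ (ℕ.+-cancelˡ-≡ (altNum f α) _ _
      (trans (sym (via π)) (trans (zebra (α ++ₚ (π ++ₚ ω)) (α ++ₚ (ρ ++ₚ ω))) (via ρ))))
    where
    α = pathBetween (zeros n) p (zeros-≼ p)
    ω = pathBetween q (ones n) (≼-ones q)
    via : (σ : MonPath _ _) → altNum f (α ++ₚ (σ ++ₚ ω)) ≡ altNum f α + (altNum f σ + altNum f ω)
    via σ = trans (altNum-++ f α _) (cong (altNum f α +_) (altNum-++ f σ ω))

  stripe-unique : Stripe f i x → Stripe f i′ x → i ≡ i′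
  stripe-unique (π , refl) (ρ , refl) = altNum-path-independent π ρ

  stripe? : ∀ i → Decidable (Stripe f i)
  stripe? i x = map′ (λ altAt≡i → subst (λ i → Stripe f i x) altAt≡i (stripe-altAt f x))
                     (stripe-unique (stripe-altAt f x))
                     (altAt f x ℕ.≟ i)

  stripe-monotone : Stripe f i x → Stripe f i′ y → x ≼ y → i ≤ i′
  stripe-monotone {i} sx sy x≼y with stripe-extend f sx x≼y
  ... | _ , i≤i″ , si″ = subst (i ≤_) (stripe-unique si″ sy) i≤i″

  stripe-convex : Convex (Stripe f i)
  stripe-convex {i} {x} {y} {z} sx sz x≼y y≼z =
    subst (λ i → Stripe f i y)
          (ℕ.≤-antisym (stripe-monotone {y = z} sy sz y≼z) (stripe-monotone {x = x} sx sy x≼y))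
          sy
    where sy = stripe-altAt f y

  minimal-lower-neighbour : MinimalIn f i x → lookup x j ≡ true →
                            (Σ ℕ λ i′ → suc i′ ≡ i × Stripe f i′ (x [ j ]≔ false))
                            × f (x [ j ]≔ false) ≢ f x
  minimal-lower-neighbour {x = x} {j} (sx , minimal) xj≡1 =
    (altAt f x′ , stripe-unique (stripe-step-≢ f fx′≢fx down sx′) sx , sx′) , fx′≢fx
    where
    x′ = x [ j ]≔ false
    down = lowering-step xj≡1
    sx′ = stripe-altAt f x′

    fx′≢fx : f x′ ≢ f x
    fx′≢fx fx′≡fx = minimal x′ (step⇒≺ down)
      (subst (λ i → Stripe f i x′) (stripe-unique (stripe-step-≡ f fx′≡fx down sx′) sx) sx′)

insertAt-step : (j : Fin (suc n)) → Step x y → Step (insertAt x j a) (insertAt y j a)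
insertAt-step zero s = ∷-step s
insertAt-step {x = _ ∷ _} (suc j) (zero , x0≡0 , refl) = zero , x0≡0 , refl
insertAt-step {x = _ ∷ _} (suc j) (suc j′ , xj′≡0 , refl) = ∷-step (insertAt-step j (j′ , xj′≡0 , refl))

insertAt-path : (j : Fin (suc n)) → MonPath x y → MonPath (insertAt x j a) (insertAt y j a)
insertAt-path j here    = here
insertAt-path j (s ∷ π) = insertAt-step j s ∷ insertAt-path j π

altNum-restrict : (f : Pt (suc n) → Bool) (j : Fin (suc n)) (π : MonPath x y) →
                  altNum (restrict f j a) π ≡ altNum f (insertAt-path {a = a} j π)
altNum-restrict f j here = refl
altNum-restrict {a = a} f j (_∷_ {x} {y} _ π) =
  cong (δ (f (insertAt x j a)) (f (insertAt y j a)) +_) (altNum-restrict f j π)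

restrict-zebra : (f : Pt n → Bool) → Zebra f → (j : Fin n) (a : Bool) → Zebra (restrict f j a)
restrict-zebra {suc n} f zebra j a π ρ = begin
  altNum (restrict f j a) π ≡⟨ altNum-restrict f j π ⟩
  altNum f π′               ≡⟨ altNum-path-independent f zebra π′ ρ′ ⟩
  altNum f ρ′               ≡⟨ altNum-restrict f j ρ ⟨
  altNum (restrict f j a) ρ ∎
  where
  open ≡-Reasoning
  π′ = insertAt-path {a = a} j π
  ρ′ = insertAt-path {a = a} j ρ

proposition2 : ∀ (n : ℕ) (f : Pt n → Bool) (k : ℕ) → Zebra f → IsAlt f k →
    -- (1) stripes 0..k are pairwise disjoint and cover {0,1}^n
    ((∀ i j x → i ≤ k → j ≤ k → Stripe f i x → Stripe f j x → i ≡ j)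
      × (∀ x → Σ ℕ λ i → i ≤ k × Stripe f i x))
    -- (2) adjacent stripes have different f-values
    × (∀ i x y → i < k → Stripe f i x → Stripe f (suc i) y → f x ≢ f y)
    -- (3) minimal point below, maximal point above
    × (∀ i x → i ≤ k → Stripe f i x →
         (Σ (Pt n) λ y → y ≼ x × MinimalIn f i y)
         × (Σ (Pt n) λ y → x ≼ y × MaximalIn f i y))
    -- (4) flipping a 1-bit of a minimal point / a 0-bit of a maximal point
    × ((∀ i x (j : Fin n) → MinimalIn f i x → lookup x j ≡ true →
          (Σ ℕ λ i' → suc i' ≡ i × Stripe f i' (x [ j ]≔ false))
          × f (x [ j ]≔ false) ≢ f x)
       × (∀ i x (j : Fin n) → MaximalIn f i x → lookup x j ≡ false →
          Stripe f (suc i) (x [ j ]≔ true) × f (x [ j ]≔ true) ≢ f x))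
    -- (5) restrictions are zebra functions
    × (∀ (j : Fin n) (b : Bool) → Zebra (restrict f j b))
proposition2 n f k zebra alt =
  ( (λ _ _ _ _ _ → stripe-unique f zebra)
  , λ x → altAt f x , stripe-≤-alt f alt (stripe-altAt f x) , stripe-altAt f x )
  , (λ _ _ _ _ → adjacent-stripes-differ f)
  , (λ i _ _ sx → minimal-below (stripe? f zebra i) (stripe-convex f zebra) sx
                , maximal-above (stripe? f zebra i) (stripe-convex f zebra) sx)
  , ( (λ _ _ _ → minimal-lower-neighbour f zebra)
    , (λ _ _ _ → maximal-upper-neighbour f) )
  , restrict-zebra f zebra
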